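{- Let $f\colon 2^{\mathcal{N}} \to \mathbb{R}^+$ be a non-negative submodular function, let $A_1, \dots, A_\ell$ be $\ell\ge1$ subsets of $\mathcal{N}$, and let $p\in[0,1]$. For each $i$, let $A_i(p)$ be a random subset of $A_i$ containing each element of $A_i$ independently with probability $p$, where the random sets $A_1(p),\dots,A_\ell(p)$ are mutually independent. Then \[ \mathbb{E}\left[f\left(\bigcup_{i=1}^\ell A_i(p)\right)\right] \geq \sum_{I \subseteq \{1,\dots,\ell\}} p^{|I|}(1 - p)^{\ell - |I|}\, f\left(\bigcup_{i \in I} A_i\right), \] where $\bigcup_{i\in\emptyset}A_i$ is defined as $\emptyset$.
   Context: $f$ is submodular if $f(A)+f(B)\ge f(A\cup B)+f(A\cap B)$ for all $A,B\subseteq\mathcal{N}$. -}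

module Defs where

open import Level using (Level; _⊔_; suc)
open import Data.Nat using (ℕ; zero; _∸_) renaming (suc to sucℕ)
open import Data.Bool using (Bool; true; false)
open import Data.List using (List; []; _∷_; concatMap; foldr)
open import Data.Vec using (Vec; []; _∷_)
open import Data.Fin.Subset using (Subset; _∪_; _∩_; ∣_∣; inside; outside) renaming (⊥ to ∅)
open import Algebra.Bundles using (CommutativeRing)
open import Relation.Binary.Core using (Rel)
open import Relation.Binary.Structures using (IsTotalOrder)

-- A (totally) ordered commutative ring: the real numbers ℝ are an instance.
-- The statement is proved for every such ring, in particular for ℝ.
record OrderedCommutativeRing (c ℓ₁ ℓ₂ : Level) : Set (suc (c ⊔ ℓ₁ ⊔ ℓ₂)) where
  field
    commutativeRing : CommutativeRing c ℓ₁
  open CommutativeRing commutativeRing public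
  field
    _≤_          : Rel Carrier ℓ₂
    isTotalOrder : IsTotalOrder _≈_ _≤_
    +-mono-≤     : ∀ {x y} z → x ≤ y → (x + z) ≤ (y + z)
    *-nonneg     : ∀ {x y} → 0# ≤ x → 0# ≤ y → 0# ≤ (x * y)

allSubsets : (n : ℕ) → List (Subset n)
allSubsets zero = [] ∷ []
allSubsets (sucℕ n) = concatMap (λ s → (inside ∷ s) ∷ (outside ∷ s) ∷ []) (allSubsets n)

allTuples : (n ℓ : ℕ) → List (Vec (Subset n) ℓ)
allTuples n zero = [] ∷ []
allTuples n (sucℕ ℓ) =
  concatMap (λ t → concatMap (λ s → (s ∷ t) ∷ []) (allSubsets n)) (allTuples n ℓ)

unionAll : ∀ {n ℓ} → Vec (Subset n) ℓ → Subset n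
unionAll [] = ∅
unionAll (a ∷ as) = a ∪ unionAll as

unionOver : ∀ {n ℓ} → Subset ℓ → Vec (Subset n) ℓ → Subset n
unionOver [] [] = ∅
unionOver (true ∷ I) (a ∷ as) = a ∪ unionOver I as
unionOver (false ∷ I) (a ∷ as) = unionOver I as

module WithRing {c ℓ₁ ℓ₂} (R : OrderedCommutativeRing c ℓ₁ ℓ₂) where
  open OrderedCommutativeRing R

  Submodular : ∀ {n} → (Subset n → Carrier) → Set (ℓ₂)
  Submodular f = ∀ A B → (f (A ∪ B) + f (A ∩ B)) ≤ (f A + f B)

  NonNegative : ∀ {n} → (Subset n → Carrier) → Set ℓ₂
  NonNegative f = ∀ A → 0# ≤ f A

  pow : Carrier → ℕ → Carrier
  pow x zero = 1#
  pow x (sucℕ k) = x * pow x k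

  sumL : ∀ {a} {X : Set a} → (X → Carrier) → List X → Carrier
  sumL g = foldr (λ x acc → g x + acc) 0#

  -- Pr[A(p) = S]: each element of A included independently with prob. p,
  -- elements outside A never included.
  probSub : ∀ {n} → Carrier → Subset n → Subset n → Carrier
  probSub p [] [] = 1#
  probSub p (true ∷ A) (true ∷ S) = p * probSub p A S
  probSub p (true ∷ A) (false ∷ S) = (1# - p) * probSub p A S
  probSub p (false ∷ A) (true ∷ S) = 0#
  probSub p (false ∷ A) (false ∷ S) = probSub p A S

  -- Pr[(A₁(p),…,A_ℓ(p)) = (S₁,…,S_ℓ)] for mutually independent A_i(p)
  probTuple : ∀ {n ℓ} → Carrier → Vec (Subset n) ℓ → Vec (Subset n) ℓ → Carrier
  probTuple p [] [] = 1#
  probTuple p (A ∷ As) (S ∷ Ss) = probSub p A S * probTuple p As Ss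

  expectedUnion : ∀ {n ℓ} → (Subset n → Carrier) → Carrier → Vec (Subset n) ℓ → Carrier
  expectedUnion {n} {ℓ} f p As =
    sumL (λ Ss → probTuple p As Ss * f (unionAll Ss)) (allTuples n ℓ)

  lowerBound : ∀ {n ℓ} → (Subset n → Carrier) → Carrier → Vec (Subset n) ℓ → Carrier
  lowerBound {n} {ℓ} f p As =
    sumL (λ I → (pow p ∣ I ∣ * pow (1# - p) (ℓ ∸ ∣ I ∣)) * f (unionOver I As)) (allSubsets ℓ)

module Submission where

-- The proof is by induction on the number ℓ of sets, in any ordered
-- commutative ring.  Two facts drive it.
--   * Bernoulli bound (one set): E[g(A(p))] ≥ (1-p) g(∅) + p g(A) for every
--     submodular g.  It is proved coordinate by coordinate; the step is the
--     two-point inequality for a single element of A, which is exactly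
--     submodularity applied to a pair of sets.
--   * Submodularity survives restriction to a coordinate and translation
--     S ↦ f(S ∪ U), since these maps preserve ∪ and ∩.
-- Splitting off the first set A, the lower bound decomposes as
--   p · LB(f(A ∪ ·), rest) + (1-p) · LB(f, rest),
-- the induction hypothesis bounds both parts by expectations over the
-- remaining sets, and the Bernoulli bound applied to S ↦ f(S ∪ ⋃ rest)
-- reinserts the random A(p).

open import Defs
open import Data.Nat using (ℕ; suc; _∸_)
open import Data.Nat.Properties using (+-∸-assoc)
open import Data.Vec using (Vec; []; _∷_)
open import Data.Fin.Subset using (Subset; _∪_; _∩_; ∣_∣; inside; outside) renaming (⊥ to ∅)
open import Data.Bool using (Bool; true; false)
open import Data.Bool.Properties using (∨-idem; ∧-idem)
open import Data.List using (List; []; _∷_; _++_; concatMap)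
open import Data.Fin.Subset.Properties
  using (∣p∣≤n; ∪-identityˡ; ∩-zeroˡ; ∪-distribˡ-∩; ∪-distribʳ-∩; ∪-idempotentCommutativeMonoid)
import Algebra.Properties.IdempotentCommutativeMonoid as IdemCommMonoid
open import Relation.Binary.Bundles using (Poset)
open import Relation.Binary.Structures using (IsTotalOrder)
import Relation.Binary.Reasoning.PartialOrder as PosetReasoning
open import Relation.Binary.PropositionalEquality using (_≡_; subst₂)
import Relation.Binary.PropositionalEquality as ≡
import Algebra.Solver.Ring.NaturalCoefficients.Default as RingSolver

∪-distribˡ-∪ : ∀ {n} (U X Y : Subset n) → U ∪ (X ∪ Y) ≡ (U ∪ X) ∪ (U ∪ Y)
∪-distribˡ-∪ {n} = IdemCommMonoid.∙-distrˡ-∙ (∪-idempotentCommutativeMonoid n)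

∪-distribʳ-∪ : ∀ {n} (U X Y : Subset n) → (X ∪ Y) ∪ U ≡ (X ∪ U) ∪ (Y ∪ U)
∪-distribʳ-∪ {n} = IdemCommMonoid.∙-distrʳ-∙ (∪-idempotentCommutativeMonoid n)

record LatticeMap {m n : ℕ} (h : Subset m → Subset n) : Set where
  field
    map-∪ : ∀ X Y → h (X ∪ Y) ≡ h X ∪ h Y
    map-∩ : ∀ X Y → h (X ∩ Y) ≡ h X ∩ h Y

-- Prepending a fixed membership bit is a lattice map (restriction of a set
-- function to the sets with a prescribed first coordinate).
cons-latticeMap : ∀ {n} (b : Bool) → LatticeMap {n} (b ∷_)
cons-latticeMap b = record
  { map-∪ = λ X Y → ≡.cong (_∷ _) (≡.sym (∨-idem b))
  ; map-∩ = λ X Y → ≡.cong (_∷ _) (≡.sym (∧-idem b)) }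

∪ˡ-latticeMap : ∀ {n} (U : Subset n) → LatticeMap (U ∪_)
∪ˡ-latticeMap U = record { map-∪ = ∪-distribˡ-∪ U ; map-∩ = ∪-distribˡ-∩ U }

∪ʳ-latticeMap : ∀ {n} (U : Subset n) → LatticeMap (_∪ U)
∪ʳ-latticeMap U = record { map-∪ = ∪-distribʳ-∪ U ; map-∩ = ∪-distribʳ-∩ U }

module _ {c ℓ₁ ℓ₂} (R : OrderedCommutativeRing c ℓ₁ ℓ₂) where
  open OrderedCommutativeRing R
  open WithRing R
  open RingSolver commutativeSemiring using (solve; _:+_; _:*_; _:=_)

  submodular-∘ : ∀ {m n} {f : Subset n → Carrier} {h : Subset m → Subset n} →
                 LatticeMap h → Submodular f → Submodular (λ S → f (h S))
  submodular-∘ {f = f} {h} hom sub X Y =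
    subst₂ (λ U V → (f U + f V) ≤ (f (h X) + f (h Y)))
           (≡.sym (map-∪ X Y)) (≡.sym (map-∩ X Y)) (sub (h X) (h Y))
    where open LatticeMap hom

  poset : Poset c ℓ₁ ℓ₂
  poset = record { isPartialOrder = IsTotalOrder.isPartialOrder isTotalOrder }

  open PosetReasoning poset

  ≤-refl : ∀ {x} → x ≤ x
  ≤-refl = IsTotalOrder.refl isTotalOrder

  +-mono₂-≤ : ∀ {a b x y} → a ≤ b → x ≤ y → (a + x) ≤ (b + y)
  +-mono₂-≤ {a} {b} {x} {y} a≤b x≤y = begin
    a + x  ≤⟨ +-mono-≤ x a≤b ⟩
    b + x  ≈⟨ +-comm b x ⟩
    x + b  ≤⟨ +-mono-≤ b x≤y ⟩
    y + b  ≈⟨ +-comm y b ⟩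
    b + y  ∎

  minus-plus : ∀ x y → (y - x) + x ≈ y
  minus-plus x y = trans (+-assoc y (- x) x) (trans (+-congˡ (-‿inverseˡ x)) (+-identityʳ y))

  x≤y⇒0≤y-x : ∀ {x y} → x ≤ y → 0# ≤ (y - x)
  x≤y⇒0≤y-x {x} {y} x≤y = begin
    0#     ≈⟨ -‿inverseʳ x ⟨
    x - x  ≤⟨ +-mono-≤ (- x) x≤y ⟩
    y - x  ∎

  *-monoˡ-≤ : ∀ {k x y} → 0# ≤ k → x ≤ y → (k * x) ≤ (k * y)
  *-monoˡ-≤ {k} {x} {y} 0≤k x≤y = begin
    k * x                  ≈⟨ +-identityˡ (k * x) ⟨
    0# + k * x             ≤⟨ +-mono-≤ (k * x) (*-nonneg 0≤k (x≤y⇒0≤y-x x≤y)) ⟩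
    k * (y - x) + k * x    ≈⟨ distribˡ k (y - x) x ⟨
    k * ((y - x) + x)      ≈⟨ *-congˡ (minus-plus x y) ⟩
    k * y                  ∎

  sumL-cong : ∀ {a} {X : Set a} {g h : X → Carrier} → (∀ x → g x ≈ h x) →
              ∀ xs → sumL g xs ≈ sumL h xs
  sumL-cong g≈h []       = refl
  sumL-cong g≈h (x ∷ xs) = +-cong (g≈h x) (sumL-cong g≈h xs)

  sumL-mono : ∀ {a} {X : Set a} {g h : X → Carrier} → (∀ x → g x ≤ h x) →
              ∀ xs → sumL g xs ≤ sumL h xs
  sumL-mono g≤h []       = ≤-refl
  sumL-mono g≤h (x ∷ xs) = +-mono₂-≤ (g≤h x) (sumL-mono g≤h xs)

  sumL-scale : ∀ {a} {X : Set a} (k : Carrier) (g : X → Carrier) xs →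
               sumL (λ x → k * g x) xs ≈ k * sumL g xs
  sumL-scale k g []       = sym (zeroʳ k)
  sumL-scale k g (x ∷ xs) =
    trans (+-congˡ (sumL-scale k g xs)) (sym (distribˡ k (g x) (sumL g xs)))

  sumL-add : ∀ {a} {X : Set a} (g h : X → Carrier) xs →
             sumL (λ x → g x + h x) xs ≈ sumL g xs + sumL h xs
  sumL-add g h []       = sym (+-identityʳ 0#)
  sumL-add g h (x ∷ xs) =
    trans (+-congˡ (sumL-add g h xs)) (interchange (g x) (h x) (sumL g xs) (sumL h xs))
    where
    interchange : ∀ a b c d → (a + b) + (c + d) ≈ (a + c) + (b + d)
    interchange = solve 4 (λ a b c d → (a :+ b) :+ (c :+ d) := (a :+ c) :+ (b :+ d)) refl

  sumL-++ : ∀ {a} {X : Set a} (g : X → Carrier) xs ys →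
            sumL g (xs ++ ys) ≈ sumL g xs + sumL g ys
  sumL-++ g []       ys = sym (+-identityˡ _)
  sumL-++ g (x ∷ xs) ys = trans (+-congˡ (sumL-++ g xs ys)) (sym (+-assoc _ _ _))

  sumL-concatMap : ∀ {a b} {X : Set a} {Y : Set b} (g : Y → Carrier) (h : X → List Y) xs →
                   sumL g (concatMap h xs) ≈ sumL (λ x → sumL g (h x)) xs
  sumL-concatMap g h []       = refl
  sumL-concatMap g h (x ∷ xs) =
    trans (sumL-++ g (h x) (concatMap h xs)) (+-congˡ (sumL-concatMap g h xs))

  sumL-allSubsets-suc : ∀ {m} (g : Subset (suc m) → Carrier) →
    sumL g (allSubsets (suc m))
      ≈ sumL (λ s → g (inside ∷ s)) (allSubsets m) + sumL (λ s → g (outside ∷ s)) (allSubsets m)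
  sumL-allSubsets-suc {m} g =
    trans (sumL-concatMap g (λ s → (inside ∷ s) ∷ (outside ∷ s) ∷ []) (allSubsets m))
   (trans (sumL-cong (λ s → +-congˡ (+-identityʳ _)) (allSubsets m))
          (sumL-add _ _ (allSubsets m)))

  sumL-allTuples-suc : ∀ {n ℓ} (g : Vec (Subset n) (suc ℓ) → Carrier) →
    sumL g (allTuples n (suc ℓ))
      ≈ sumL (λ t → sumL (λ s → g (s ∷ t)) (allSubsets n)) (allTuples n ℓ)
  sumL-allTuples-suc {n} {ℓ} g =
    trans (sumL-concatMap g (λ t → concatMap (λ s → (s ∷ t) ∷ []) (allSubsets n)) (allTuples n ℓ))
          (sumL-cong (λ t → trans (sumL-concatMap g (λ s → (s ∷ t) ∷ []) (allSubsets n))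
                                  (sumL-cong (λ s → +-identityʳ _) (allSubsets n)))
                     (allTuples n ℓ))

  weighted-linear : ∀ {a} {X : Set a} (w g h : X → Carrier) (α β : Carrier) xs →
    α * sumL (λ x → w x * g x) xs + β * sumL (λ x → w x * h x) xs
      ≈ sumL (λ x → w x * (α * g x + β * h x)) xs
  weighted-linear w g h α β xs = sym (
    trans (sumL-cong (λ x → distribute (w x) (g x) (h x)) xs)
   (trans (sumL-add _ _ xs)
          (+-cong (sumL-scale α _ xs) (sumL-scale β _ xs))))
    where
    distribute : ∀ u y z → u * (α * y + β * z) ≈ α * (u * y) + β * (u * z)
    distribute = solve 5 (λ α β u y z → u :* (α :* y :+ β :* z) := α :* (u :* y) :+ β :* (u :* z))
                         refl α β

  weighted-mono : ∀ {a} {X : Set a} (w : X → Carrier) {g h : X → Carrier} →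
    (∀ x → 0# ≤ w x) → (∀ x → g x ≤ h x) → ∀ xs →
    sumL (λ x → w x * g x) xs ≤ sumL (λ x → w x * h x) xs
  weighted-mono w 0≤w g≤h = sumL-mono (λ x → *-monoˡ-≤ (0≤w x) (g≤h x))

  weighted-factor : ∀ {a} {X : Set a} (k : Carrier) (w g : X → Carrier) xs →
    sumL (λ x → (k * w x) * g x) xs ≈ k * sumL (λ x → w x * g x) xs
  weighted-factor k w g xs =
    trans (sumL-cong (λ x → *-assoc k (w x) (g x)) xs) (sumL-scale k _ xs)

  -- The two-point inequality: the one-element case of the Bernoulli bound.
  -- If b + c ≤ a + d then, with weights p and q = 1 - p,
  --   q c + p b ≤ p (q a + p b) + q (q c + p d).
  two-point : ∀ {p q a b c d} → 0# ≤ p → 0# ≤ q → p + q ≈ 1# → (b + c) ≤ (a + d) →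
              (q * c + p * b) ≤ (p * (q * a + p * b) + q * (q * c + p * d))
  two-point {p} {q} {a} {b} {c} {d} 0≤p 0≤q p+q≈1 b+c≤a+d = begin
    q * c + p * b                                  ≈⟨ *-identityˡ _ ⟨
    1# * (q * c + p * b)                           ≈⟨ *-congʳ p+q≈1 ⟨
    (p + q) * (q * c + p * b)                      ≈⟨ expand p q a b c d ⟩
    (p * q) * (b + c) + (p * p * b + q * q * c)    ≤⟨ +-mono-≤ _ (*-monoˡ-≤ (*-nonneg 0≤p 0≤q) b+c≤a+d) ⟩
    (p * q) * (a + d) + (p * p * b + q * q * c)    ≈⟨ regroup p q a b c d ⟩
    p * (q * a + p * b) + q * (q * c + p * d)      ∎
    where
    expand : ∀ p q a b c d → (p + q) * (q * c + p * b) ≈ (p * q) * (b + c) + (p * p * b + q * q * c)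
    expand = solve 6 (λ p q a b c d → (p :+ q) :* (q :* c :+ p :* b)
                        := (p :* q) :* (b :+ c) :+ (p :* p :* b :+ q :* q :* c)) refl
    regroup : ∀ p q a b c d → (p * q) * (a + d) + (p * p * b + q * q * c)
                              ≈ p * (q * a + p * b) + q * (q * c + p * d)
    regroup = solve 6 (λ p q a b c d → (p :* q) :* (a :+ d) :+ (p :* p :* b :+ q :* q :* c)
                         := p :* (q :* a :+ p :* b) :+ q :* (q :* c :+ p :* d)) refl

  module _ (p : Carrier) (0≤p : 0# ≤ p) (p≤1 : p ≤ 1#) where

    q : Carrier
    q = 1# - p

    0≤q : 0# ≤ q
    0≤q = x≤y⇒0≤y-x p≤1

    p+q≈1 : p + q ≈ 1#
    p+q≈1 = trans (+-comm p q) (minus-plus p 1#)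

    0≤1 : 0# ≤ 1#
    0≤1 = begin
      0#       ≈⟨ +-identityʳ 0# ⟨
      0# + 0#  ≤⟨ +-mono₂-≤ 0≤p 0≤q ⟩
      p + q    ≈⟨ p+q≈1 ⟩
      1#       ∎

    probSub-nonneg : ∀ {n} (A S : Subset n) → 0# ≤ probSub p A S
    probSub-nonneg []           []           = 0≤1
    probSub-nonneg (true  ∷ A)  (true  ∷ S)  = *-nonneg 0≤p (probSub-nonneg A S)
    probSub-nonneg (true  ∷ A)  (false ∷ S)  = *-nonneg 0≤q (probSub-nonneg A S)
    probSub-nonneg (false ∷ A)  (true  ∷ S)  = ≤-refl
    probSub-nonneg (false ∷ A)  (false ∷ S)  = probSub-nonneg A S

    probTuple-nonneg : ∀ {n ℓ} (As Ss : Vec (Subset n) ℓ) → 0# ≤ probTuple p As Ss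
    probTuple-nonneg []       []       = 0≤1
    probTuple-nonneg (A ∷ As) (S ∷ Ss) = *-nonneg (probSub-nonneg A S) (probTuple-nonneg As Ss)

    expect : ∀ {n} → Subset n → (Subset n → Carrier) → Carrier
    expect {n} A g = sumL (λ S → probSub p A S * g S) (allSubsets n)

    expectTuple : ∀ {n ℓ} → Vec (Subset n) ℓ → (Vec (Subset n) ℓ → Carrier) → Carrier
    expectTuple {n} {ℓ} As G = sumL (λ Ss → probTuple p As Ss * G Ss) (allTuples n ℓ)

    expect-inside : ∀ {n} (A : Subset n) (g : Subset (suc n) → Carrier) →
      expect (inside ∷ A) g ≈ p * expect A (λ S → g (inside ∷ S)) + q * expect A (λ S → g (outside ∷ S))
    expect-inside {n} A g =
      trans (sumL-allSubsets-suc (λ S → probSub p (inside ∷ A) S * g S))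
            (+-cong (weighted-factor p (probSub p A) (λ S → g (inside ∷ S)) (allSubsets n))
                    (weighted-factor q (probSub p A) (λ S → g (outside ∷ S)) (allSubsets n)))

    expect-outside : ∀ {n} (A : Subset n) (g : Subset (suc n) → Carrier) →
      expect (outside ∷ A) g ≈ expect A (λ S → g (outside ∷ S))
    expect-outside {n} A g = begin-equality
      expect (outside ∷ A) g          ≈⟨ sumL-allSubsets-suc (λ S → probSub p (outside ∷ A) S * g S) ⟩
      sumL (λ S → 0# * g (inside ∷ S)) (allSubsets n) + expect A (λ S → g (outside ∷ S))
                                      ≈⟨ +-congʳ (sumL-scale 0# (λ S → g (inside ∷ S)) (allSubsets n)) ⟩
      0# * sumL (λ S → g (inside ∷ S)) (allSubsets n) + expect A (λ S → g (outside ∷ S))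
                                      ≈⟨ +-congʳ (zeroˡ _) ⟩
      0# + expect A (λ S → g (outside ∷ S))
                                      ≈⟨ +-identityˡ _ ⟩
      expect A (λ S → g (outside ∷ S)) ∎

    expectTuple-cons : ∀ {n ℓ} (A : Subset n) (As : Vec (Subset n) ℓ) (G : Vec (Subset n) (suc ℓ) → Carrier) →
      expectTuple (A ∷ As) G ≈ expectTuple As (λ t → expect A (λ S → G (S ∷ t)))
    expectTuple-cons {n} {ℓ} A As G =
      trans (sumL-allTuples-suc (λ Ss → probTuple p (A ∷ As) Ss * G Ss))
            (sumL-cong (λ t → trans (sumL-cong (λ S → swap (probSub p A S) (probTuple p As t) (G (S ∷ t)))
                                               (allSubsets n))
                                    (sumL-scale (probTuple p As t) (λ S → probSub p A S * G (S ∷ t))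
                                                (allSubsets n)))
                       (allTuples n ℓ))
      where
      swap : ∀ x y z → (x * y) * z ≈ y * (x * z)
      swap = solve 3 (λ x y z → (x :* y) :* z := y :* (x :* z)) refl

    bernoulli-bound : ∀ {n} (g : Subset n → Carrier) → Submodular g → (A : Subset n) →
                      (q * g ∅ + p * g A) ≤ expect A g
    bernoulli-bound g sub [] = begin
      q * g [] + p * g []     ≈⟨ distribʳ (g []) q p ⟨
      (q + p) * g []          ≈⟨ *-congʳ (trans (+-comm q p) p+q≈1) ⟩
      1# * g []               ≈⟨ +-identityʳ _ ⟨
      expect [] g             ∎
    bernoulli-bound {suc n} g sub (false ∷ A) = begin
      q * g (outside ∷ ∅) + p * g (outside ∷ A)  ≤⟨ bernoulli-bound gₒ (submodular-∘ (cons-latticeMap false) sub) A ⟩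
      expect A gₒ                                ≈⟨ expect-outside A g ⟨
      expect (false ∷ A) g                       ∎
      where
      gₒ : Subset n → Carrier
      gₒ S = g (outside ∷ S)
    bernoulli-bound {suc n} g sub (true ∷ A) = begin
      q * g (outside ∷ ∅) + p * g (inside ∷ A)
        ≤⟨ two-point 0≤p 0≤q p+q≈1 corners ⟩
      p * (q * gᵢ ∅ + p * gᵢ A) + q * (q * gₒ ∅ + p * gₒ A)
        ≤⟨ +-mono₂-≤ (*-monoˡ-≤ 0≤p (bernoulli-bound gᵢ (submodular-∘ (cons-latticeMap true) sub) A))
                     (*-monoˡ-≤ 0≤q (bernoulli-bound gₒ (submodular-∘ (cons-latticeMap false) sub) A)) ⟩
      p * expect A gᵢ + q * expect A gₒ
        ≈⟨ expect-inside A g ⟨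
      expect (true ∷ A) g ∎
      where
      gᵢ gₒ : Subset n → Carrier
      gᵢ S = g (inside ∷ S)
      gₒ S = g (outside ∷ S)
      -- submodularity for {0} and the rest of the set: union inside ∷ A, meet ∅
      corners : (g (inside ∷ A) + g (outside ∷ ∅)) ≤ (gᵢ ∅ + gₒ A)
      corners = subst₂ (λ U V → (g (inside ∷ U) + g (outside ∷ V)) ≤ (gᵢ ∅ + gₒ A))
                       (∪-identityˡ A) (∩-zeroˡ A) (sub (inside ∷ ∅) (outside ∷ A))

    weight : ∀ {ℓ} → Subset ℓ → Carrier
    weight {ℓ} I = pow p ∣ I ∣ * pow q (ℓ ∸ ∣ I ∣)

    weight-inside : ∀ {ℓ} (I : Subset ℓ) → weight (inside ∷ I) ≈ p * weight I
    weight-inside I = *-assoc p _ _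

    weight-outside : ∀ {ℓ} (I : Subset ℓ) → weight (outside ∷ I) ≈ q * weight I
    weight-outside {ℓ} I = begin-equality
      pow p ∣ I ∣ * pow q (suc ℓ ∸ ∣ I ∣)   ≡⟨ ≡.cong (λ k → pow p ∣ I ∣ * pow q k) (+-∸-assoc 1 (∣p∣≤n I)) ⟩
      pow p ∣ I ∣ * (q * pow q (ℓ ∸ ∣ I ∣)) ≈⟨ x*[y*z]≈y*[x*z] _ _ _ ⟩
      q * weight I                            ∎
      where
      x*[y*z]≈y*[x*z] : ∀ x y z → x * (y * z) ≈ y * (x * z)
      x*[y*z]≈y*[x*z] = solve 3 (λ x y z → x :* (y :* z) := y :* (x :* z)) refl

    lowerBound-cons : ∀ {n ℓ} (f : Subset n → Carrier) (A : Subset n) (As : Vec (Subset n) ℓ) →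
      lowerBound f p (A ∷ As) ≈ p * lowerBound (λ S → f (A ∪ S)) p As + q * lowerBound f p As
    lowerBound-cons {n} {ℓ} f A As =
      trans (sumL-allSubsets-suc (λ I → weight I * f (unionOver I (A ∷ As)))) (+-cong chosen skipped)
      where
      Is : List (Subset ℓ)
      Is = allSubsets ℓ
      chosen : sumL (λ I → weight (inside ∷ I) * f (A ∪ unionOver I As)) Is
                 ≈ p * lowerBound (λ S → f (A ∪ S)) p As
      chosen = trans (sumL-cong (λ I → *-congʳ (weight-inside I)) Is)
                     (weighted-factor p weight (λ I → f (A ∪ unionOver I As)) Is)
      skipped : sumL (λ I → weight (outside ∷ I) * f (unionOver I As)) Is ≈ q * lowerBound f p As
      skipped = trans (sumL-cong (λ I → *-congʳ (weight-outside I)) Is)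
                      (weighted-factor q weight (λ I → f (unionOver I As)) Is)

    lowerBound≤expectedUnion : ∀ {n ℓ} (f : Subset n → Carrier) → Submodular f →
                               (As : Vec (Subset n) ℓ) → lowerBound f p As ≤ expectedUnion f p As
    lowerBound≤expectedUnion f sub [] = begin
      lowerBound f p []     ≈⟨ +-congʳ (*-congʳ (*-identityʳ 1#)) ⟩
      expectedUnion f p []  ∎
    lowerBound≤expectedUnion {n} {suc ℓ} f sub (A ∷ As) = begin
      lowerBound f p (A ∷ As)
        ≈⟨ lowerBound-cons f A As ⟩
      p * lowerBound f⟨A∪_⟩ p As + q * lowerBound f p As
        ≤⟨ +-mono₂-≤ (*-monoˡ-≤ 0≤p (lowerBound≤expectedUnion f⟨A∪_⟩ (submodular-∘ (∪ˡ-latticeMap A) sub) As))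
                     (*-monoˡ-≤ 0≤q (lowerBound≤expectedUnion f sub As)) ⟩
      p * expectedUnion f⟨A∪_⟩ p As + q * expectedUnion f p As
        ≈⟨ +-comm _ _ ⟩
      q * expectedUnion f p As + p * expectedUnion f⟨A∪_⟩ p As
        ≈⟨ weighted-linear (probTuple p As) _ _ q p (allTuples n ℓ) ⟩
      expectTuple As (λ t → q * f (unionAll t) + p * f (A ∪ unionAll t))
        ≤⟨ weighted-mono (probTuple p As) (probTuple-nonneg As) bernoulli-step (allTuples n ℓ) ⟩
      expectTuple As (λ t → expect A (λ S → f (S ∪ unionAll t)))
        ≈⟨ expectTuple-cons A As (λ Ss → f (unionAll Ss)) ⟨
      expectedUnion f p (A ∷ As) ∎
      where
      f⟨A∪_⟩ : Subset n → Carrier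
      f⟨A∪_⟩ S = f (A ∪ S)
      -- the Bernoulli bound for S ↦ f(S ∪ U), where U is the union of the other sets
      bernoulli-step : ∀ t → (q * f (unionAll t) + p * f (A ∪ unionAll t))
                               ≤ expect A (λ S → f (S ∪ unionAll t))
      bernoulli-step t =
        subst₂ (λ V W → (q * f V + p * f W) ≤ expect A (λ S → f (S ∪ U)))
               (∪-identityˡ U) ≡.refl
               (bernoulli-bound (λ S → f (S ∪ U)) (submodular-∘ (∪ʳ-latticeMap U) sub) A)
        where U = unionAll t

lemmaC2 : ∀ {c ℓ₁ ℓ₂} (R : OrderedCommutativeRing c ℓ₁ ℓ₂) →
    let open OrderedCommutativeRing R
        open WithRing R
    in (n : ℕ) (f : Subset n → Carrier) → NonNegative f → Submodular f →
       (k : ℕ) (A : Vec (Subset n) (suc k)) (p : Carrier) → 0# ≤ p → p ≤ 1# →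
       lowerBound f p A ≤ expectedUnion f p A
lemmaC2 R n f _ sub k A p 0≤p p≤1 = lowerBound≤expectedUnion R p 0≤p p≤1 f sub A
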